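{- Let $G$ be a unicyclic graph on $n\geq 5$ vertices whose cycle has length at least four. Then $\operatorname{Z}(\overline{G})\leq n-3$.
   Context: All graphs are finite, simple and undirected. A unicyclic graph is a connected graph containing exactly one cycle. $\overline{G}$ denotes the complement of $G$ (same vertex set; distinct vertices adjacent iff not adjacent in $G$). Zero forcing: given an initial set $B\subseteq V(G)$ of blue vertices (all others white), a blue vertex with exactly one white neighbor may turn that neighbor blue; $B$ is a zero forcing set if repeated application makes all vertices blue. $\operatorname{Z}(G)$ is the minimum size of a zero forcing set of $G$. -}

module Defs where

open import Data.Nat using (ℕ; zero; suc; _+_; _≤_)
open import Data.Fin using (Fin; zero; suc; inject₁; fromℕ)
open import Data.Fin.Subset using (Subset; _∈_; ∣_∣)
open import Data.Product using (Σ; ∃; _×_; _,_)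
open import Data.Sum using (_⊎_)
open import Relation.Nullary using (¬_)
open import Relation.Binary.PropositionalEquality using (_≡_; _≢_)
open import Function.Definitions using (Injective)

record Graph (n : ℕ) : Set₁ where
  field
    Adj   : Fin n → Fin n → Set
    sym   : ∀ {u v} → Adj u v → Adj v u
    irrefl : ∀ {u} → ¬ Adj u u
open Graph public

complement : ∀ {n} → Graph n → Graph n
complement G = record
  { Adj = λ u v → (u ≢ v) × ¬ Adj G u v
  ; sym = λ { (u≢v , ¬a) → (λ e → u≢v (Relation.Binary.PropositionalEquality.sym e)) , (λ a → ¬a (sym G a)) }
  ; irrefl = λ { (u≢u , _) → u≢u Relation.Binary.PropositionalEquality.refl }
  }

data Reach {n} (G : Graph n) : Fin n → Fin n → Set where
  here : ∀ {u} → Reach G u u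
  step : ∀ {u v w} → Adj G u v → Reach G v w → Reach G u w

Connected : ∀ {n} → Graph n → Set
Connected G = ∀ u v → Reach G u v

-- A cycle of length (3 + m): an injective sequence c 0, …, c (m+2) of
-- vertices with c i ~ c (i+1) and c (m+2) ~ c 0.
record Cycle {n} (G : Graph n) (m : ℕ) : Set where
  field
    vert  : Fin (suc (suc (suc m))) → Fin n
    inj   : Injective _≡_ _≡_ vert
    path  : ∀ (i : Fin (suc (suc m))) → Adj G (vert (inject₁ i)) (vert (suc i))
    close : Adj G (vert (fromℕ (suc (suc m)))) (vert zero)
open Cycle public

cycleLength : ∀ {n} {G : Graph n} {m} → Cycle G m → ℕ
cycleLength {m = m} _ = 3 + m

SamePair : ∀ {n} → Fin n → Fin n → Fin n → Fin n → Set
SamePair a b u v = (a ≡ u × b ≡ v) ⊎ (a ≡ v × b ≡ u)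

CycleEdge : ∀ {n} {G : Graph n} {m} → Cycle G m → Fin n → Fin n → Set
CycleEdge {m = m} c u v =
  (∃ λ (i : Fin (suc (suc m))) → SamePair (vert c (inject₁ i)) (vert c (suc i)) u v)
  ⊎ SamePair (vert c (fromℕ (suc (suc m)))) (vert c zero) u v

SameCycle : ∀ {n} {G : Graph n} {m m'} → Cycle G m → Cycle G m' → Set
SameCycle c c' = ∀ u v → (CycleEdge c u v → CycleEdge c' u v) × (CycleEdge c' u v → CycleEdge c u v)

-- Unicyclic: connected with exactly one cycle (up to being the same subgraph).
-- We expose the unique cycle as data so that its length can be constrained.
HasUniqueCycle : ∀ {n} → (G : Graph n) → ∀ {m} → Cycle G m → Set
HasUniqueCycle G c = ∀ m' (c' : Cycle G m') → SameCycle c c'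

Unicyclic : ∀ {n} → Graph n → Set
Unicyclic G = Connected G × (∃ λ m → Σ (Cycle G m) λ c → HasUniqueCycle G c)

UnicyclicWithCycleLength≥ : ∀ {n} → Graph n → ℕ → Set
UnicyclicWithCycleLength≥ G k =
  Connected G × (∃ λ m → Σ (Cycle G m) λ c → HasUniqueCycle G c × k ≤ cycleLength c)

-- Zero forcing: the set of vertices eventually coloured blue from B.
-- v becomes blue if it is in B, or some blue u adjacent to v has all its
-- other neighbours blue (so v is u's unique white neighbour).
data Blue {n} (G : Graph n) (B : Subset n) : Fin n → Set where
  initial : ∀ {v} → v ∈ B → Blue G B v
  force   : ∀ {u v} → Blue G B u → Adj G u v
          → (∀ w → Adj G u w → w ≢ v → Blue G B w) → Blue G B v

IsZeroForcingSet : ∀ {n} → Graph n → Subset n → Set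
IsZeroForcingSet G B = ∀ v → Blue G B v

ZeroForcingNumber≤ : ∀ {n} → Graph n → ℕ → Set
ZeroForcingNumber≤ {n} G k = ∃ λ (B : Subset n) → IsZeroForcingSet G B × ∣ B ∣ ≤ k

module Submission where

-- The complement of an induced path P₄ is again an induced P₄, and a graph containing an
-- induced P₄ a–b–c–d has the zero forcing set V ∖ {b, c, d}: a forces b, then b forces c,
-- then c forces d. So it suffices to find an induced P₄ in G. In a unicyclic graph, a path on
-- four vertices that misses some vertex of the cycle has no chord, since a chord would close
-- a triangle or a 4-cycle different from the unique cycle. If the cycle has length at least 5,
-- take four consecutive cycle vertices; if it has length 4, then n ≥ 5 and connectivity give a
-- vertex p off the cycle adjacent to some cycle vertex, and p followed by three consecutive
-- cycle vertices misses the fourth.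

open import Defs
open import Data.Nat as Nat using (ℕ; _+_; _≤_; _<_; _∸_; s≤s)
open import Data.Nat.Properties using (≤-trans; <⇒≱)
open import Data.Fin using (Fin; zero; suc; inject₁; fromℕ; #_)
open import Data.Fin.Relation.Unary.Top using (view; ‵fromℕ; ‵inject₁)
open import Data.Fin.Properties using (_≟_; any?; ¬∀⟶∃¬; injective⇒≤)
open import Data.Fin.Subset using (Subset; ⊤; _-_; ∣_∣)
open import Data.Fin.Subset.Properties using (∈⊤; x∈p∧x≢y⇒x∈p-y; x∈p⇒∣p-x∣<∣p∣; ∣⊤∣≡n)
open import Data.Vec using (Vec; []; _∷_; lookup)
open import Data.Vec.Relation.Unary.AllPairs using ([]; _∷_)
open import Data.Vec.Relation.Unary.All using (All; []; _∷_)
open import Data.Vec.Relation.Unary.All.Properties using (lookup⁺)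
open import Data.Vec.Relation.Unary.Unique.Propositional using (Unique)
open import Data.Vec.Relation.Unary.Unique.Propositional.Properties using (lookup-injective)
open import Data.Product using (∃; _×_; _,_; proj₁; proj₂)
open import Data.Sum using (inj₁; inj₂)
open import Data.Empty using (⊥-elim)
open import Function using (_∘_)
open import Function.Definitions using (Injective)
open import Relation.Nullary using (¬_; yes; no)
open import Relation.Binary.PropositionalEquality using (_≡_; _≢_; refl; cong; subst; trans; ≢-sym)
  renaming (sym to ≡-sym)

private
  variable
    n m m′ : ℕ

adj⇒≢ : (G : Graph n) {u v : Fin n} → Adj G u v → u ≢ v
adj⇒≢ G u~v refl = irrefl G u~v

adj⇒complement² : (G : Graph n) {u v : Fin n} → Adj G u v → Adj (complement (complement G)) u v
adj⇒complement² G u~v = adj⇒≢ G u~v , λ (_ , u≁v) → u≁v u~v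

-- Non-edges are recorded as edges of the complement, which also carries the distinctness
-- of the endpoints.
record InducedPath₄ (G : Graph n) (a b c d : Fin n) : Set where
  field
    a~b : Adj G a b
    b~c : Adj G b c
    c~d : Adj G c d
    a≁c : Adj (complement G) a c
    a≁d : Adj (complement G) a d
    b≁d : Adj (complement G) b d

complement-inducedPath₄ : (G : Graph n) {a b c d : Fin n} →
  InducedPath₄ G a b c d → InducedPath₄ (complement G) c a d b
complement-inducedPath₄ G P = record
  { a~b = Graph.sym (complement G) a≁c
  ; b~c = a≁d
  ; c~d = Graph.sym (complement G) b≁d
  ; a≁c = adj⇒complement² G c~d
  ; a≁d = adj⇒complement² G (Graph.sym G b~c)
  ; b≁d = adj⇒complement² G a~b
  }
  where open InducedPath₄ P

∣⊤-x-y-z∣≤n∸3 : {x y z : Fin n} → x ≢ y → x ≢ z → y ≢ z → ∣ ⊤ - x - y - z ∣ ≤ n ∸ 3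
∣⊤-x-y-z∣≤n∸3 {n} {x} {y} {z} x≢y x≢z y≢z =
  lower (≤-trans (s≤s (s≤s z-removed)) (≤-trans (s≤s y-removed) x-removed))
  where
  x-removed : ∣ ⊤ - x ∣ < n
  x-removed = subst (∣ ⊤ - x ∣ <_) (∣⊤∣≡n n) (x∈p⇒∣p-x∣<∣p∣ (∈⊤ {x = x}))
  y-removed : ∣ ⊤ - x - y ∣ < ∣ ⊤ - x ∣
  y-removed = x∈p⇒∣p-x∣<∣p∣ (x∈p∧x≢y⇒x∈p-y ∈⊤ (≢-sym x≢y))
  z-removed : ∣ ⊤ - x - y - z ∣ < ∣ ⊤ - x - y ∣
  z-removed = x∈p⇒∣p-x∣<∣p∣ (x∈p∧x≢y⇒x∈p-y (x∈p∧x≢y⇒x∈p-y ∈⊤ (≢-sym x≢z)) (≢-sym y≢z))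
  lower : ∀ {k l} → 3 + k ≤ l → k ≤ l ∸ 3
  lower (s≤s (s≤s (s≤s k≤l))) = k≤l

inducedPath₄⇒Z≤n∸3 : (G : Graph n) {a b c d : Fin n} →
  InducedPath₄ G a b c d → ZeroForcingNumber≤ G (n ∸ 3)
inducedPath₄⇒Z≤n∸3 {n} G {a} {b} {c} {d} P = B , blue₃ , ∣⊤-x-y-z∣≤n∸3 b≢c b≢d c≢d
  where
  open InducedPath₄ P
  B : Subset n
  B = ⊤ - b - c - d

  b≢c : b ≢ c
  b≢c = adj⇒≢ G b~c
  c≢d : c ≢ d
  c≢d = adj⇒≢ G c~d
  b≢d : b ≢ d
  b≢d = proj₁ b≁d

  blue₀ : ∀ w → w ≢ b → w ≢ c → w ≢ d → Blue G B w
  blue₀ w w≢b w≢c w≢d = initial (x∈p∧x≢y⇒x∈p-y (x∈p∧x≢y⇒x∈p-y (x∈p∧x≢y⇒x∈p-y ∈⊤ w≢b) w≢c) w≢d)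

  blue₁ : ∀ w → w ≢ c → w ≢ d → Blue G B w
  blue₁ w w≢c w≢d with w ≟ b
  ... | no w≢b = blue₀ w w≢b w≢c w≢d
  ... | yes refl = force (blue₀ a (adj⇒≢ G a~b) (proj₁ a≁c) (proj₁ a≁d)) a~b
    λ { u a~u u≢b → blue₀ u u≢b (λ { refl → proj₂ a≁c a~u }) (λ { refl → proj₂ a≁d a~u }) }

  blue₂ : ∀ w → w ≢ d → Blue G B w
  blue₂ w w≢d with w ≟ c
  ... | no w≢c = blue₁ w w≢c w≢d
  ... | yes refl = force (blue₁ b b≢c b≢d) b~c
    λ { u b~u u≢c → blue₁ u u≢c (λ { refl → proj₂ b≁d b~u }) }

  blue₃ : IsZeroForcingSet G B
  blue₃ w with w ≟ d
  ... | no w≢d = blue₂ w w≢d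
  ... | yes refl = force (blue₂ c c≢d) c~d λ u _ u≢d → blue₂ u u≢d

HasInducedPath₄ : Graph n → Set
HasInducedPath₄ {n} G = ∃ λ (a : Fin n) → ∃ λ b → ∃ λ c → ∃ λ d → InducedPath₄ G a b c d

hasInducedPath₄⇒Z-complement≤n∸3 : (G : Graph n) → HasInducedPath₄ G → ZeroForcingNumber≤ (complement G) (n ∸ 3)
hasInducedPath₄⇒Z-complement≤n∸3 G (_ , _ , _ , _ , P) = inducedPath₄⇒Z≤n∸3 (complement G) (complement-inducedPath₄ G P)

vert-≢ : {G : Graph n} (C : Cycle G m) {i j : Fin (3 + m)} → i ≢ j → vert C i ≢ vert C j
vert-≢ C i≢j e = i≢j (inj C e)

cycleEdge-from : {G : Graph n} (C : Cycle G m) (j : Fin (3 + m)) → ∃ λ y → CycleEdge C (vert C j) y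
cycleEdge-from C j with view j
... | ‵fromℕ = vert C zero , inj₂ (inj₁ (refl , refl))
... | ‵inject₁ i = vert C (suc i) , inj₁ (i , inj₁ (refl , refl))

cycleEdge-endpoint : {G : Graph n} (C : Cycle G m) {x y : Fin n} → CycleEdge C x y → ∃ λ i → vert C i ≡ x
cycleEdge-endpoint C (inj₁ (i , inj₁ (e , _))) = inject₁ i , e
cycleEdge-endpoint C (inj₁ (i , inj₂ (_ , e))) = suc i , e
cycleEdge-endpoint C (inj₂ (inj₁ (e , _))) = fromℕ _ , e
cycleEdge-endpoint C (inj₂ (inj₂ (_ , e))) = zero , e

uniqueCycle-through : {G : Graph n} (C : Cycle G m) → HasUniqueCycle G C →
  (C′ : Cycle G m′) (j : Fin (3 + m)) → ∃ λ i → vert C′ i ≡ vert C j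
uniqueCycle-through C unique C′ j =
  let y , e = cycleEdge-from C j in cycleEdge-endpoint C′ (proj₁ (unique _ C′ (vert C j) y) e)

triangle : (G : Graph n) {x y z : Fin n} → Adj G x y → Adj G y z → Adj G z x → Cycle G 0
triangle G {x} {y} {z} x~y y~z z~x = record
  { vert = lookup (x ∷ y ∷ z ∷ [])
  ; inj = λ {i} {j} → lookup-injective distinct i j
  ; path = λ { zero → x~y ; (suc zero) → y~z }
  ; close = z~x
  }
  where
  distinct : Unique (x ∷ y ∷ z ∷ [])
  distinct = (adj⇒≢ G x~y ∷ ≢-sym (adj⇒≢ G z~x) ∷ []) ∷ (adj⇒≢ G y~z ∷ []) ∷ [] ∷ []

square : (G : Graph n) {x y z w : Fin n} → x ≢ z → y ≢ w →
  Adj G x y → Adj G y z → Adj G z w → Adj G w x → Cycle G 1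
square G {x} {y} {z} {w} x≢z y≢w x~y y~z z~w w~x = record
  { vert = lookup (x ∷ y ∷ z ∷ w ∷ [])
  ; inj = λ {i} {j} → lookup-injective distinct i j
  ; path = λ { zero → x~y ; (suc zero) → y~z ; (suc (suc zero)) → z~w }
  ; close = w~x
  }
  where
  distinct : Unique (x ∷ y ∷ z ∷ w ∷ [])
  distinct = (adj⇒≢ G x~y ∷ x≢z ∷ ≢-sym (adj⇒≢ G w~x) ∷ [])
           ∷ (adj⇒≢ G y~z ∷ y≢w ∷ [])
           ∷ (adj⇒≢ G z~w ∷ [])
           ∷ [] ∷ []

avoidsCycleVertex⇒inducedPath₄ : {G : Graph n} (C : Cycle G m) → HasUniqueCycle G C → (j : Fin (3 + m)) →
  {a b c d : Fin n} → All (_≢ vert C j) (a ∷ b ∷ c ∷ d ∷ []) → a ≢ c → a ≢ d → b ≢ d →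
  Adj G a b → Adj G b c → Adj G c d → InducedPath₄ G a b c d
avoidsCycleVertex⇒inducedPath₄ {n} {G = G} C unique j (a≢x ∷ b≢x ∷ c≢x ∷ d≢x ∷ []) a≢c a≢d b≢d a~b b~c c~d = record
  { a~b = a~b ; b~c = b~c ; c~d = c~d
  ; a≁c = a≢c , λ a~c → no-cycle (triangle G a~b b~c (sym G a~c)) (avoiding (a≢x ∷ b≢x ∷ c≢x ∷ []))
  ; a≁d = a≢d , λ a~d → no-cycle (square G a≢c b≢d a~b b~c c~d (sym G a~d)) (avoiding (a≢x ∷ b≢x ∷ c≢x ∷ d≢x ∷ []))
  ; b≁d = b≢d , λ b~d → no-cycle (triangle G b~c c~d (sym G b~d)) (avoiding (b≢x ∷ c≢x ∷ d≢x ∷ []))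
  }
  where
  no-cycle : ∀ {k} (C′ : Cycle G k) → ¬ (∀ i → vert C′ i ≢ vert C j)
  no-cycle C′ avoids = let i , e = uniqueCycle-through C unique C′ j in avoids i e

  avoiding : ∀ {k} {vs : Vec (Fin n) k} → All (_≢ vert C j) vs → ∀ i → lookup vs i ≢ vert C j
  avoiding = lookup⁺

∃-outside-image : m < n → (f : Fin m → Fin n) → ∃ λ x → ∀ i → x ≢ f i
∃-outside-image {m} {n} m<n f =
  let x , missed = ¬∀⟶∃¬ n (λ x → ∃ λ i → f i ≡ x) (λ x → any? (λ i → f i ≟ x)) ¬surjective
  in x , λ i x≡fi → missed (i , ≡-sym x≡fi)
  where
  ¬surjective : ¬ (∀ x → ∃ λ i → f i ≡ x)
  ¬surjective surjective = <⇒≱ m<n (injective⇒≤ section-injective)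
    where
    section-injective : Injective _≡_ _≡_ (proj₁ ∘ surjective)
    section-injective {x} {y} e = trans (≡-sym (proj₂ (surjective x))) (trans (cong f e) (proj₂ (surjective y)))

reach⇒boundary-edge : (G : Graph n) (f : Fin m → Fin n) {x y : Fin n} → Reach G x y →
  (∀ i → x ≢ f i) → (∃ λ j → f j ≡ y) → ∃ λ p → (∀ i → p ≢ f i) × ∃ λ i → Adj G p (f i)
reach⇒boundary-edge G f here x∉f (j , fj≡x) = ⊥-elim (x∉f j (≡-sym fj≡x))
reach⇒boundary-edge G f {x} (step {v = v} x~v v⇝y) x∉f y∈f with any? (λ i → f i ≟ v)
... | yes (i , fi≡v) = x , x∉f , i , subst (Adj G x) (≡-sym fi≡v) x~v
... | no v∉f = reach⇒boundary-edge G f v⇝y (λ i v≡fi → v∉f (i , ≡-sym v≡fi)) y∈f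

longCycle⇒hasInducedPath₄ : {G : Graph n} (C : Cycle G (2 + m)) → HasUniqueCycle G C → HasInducedPath₄ G
longCycle⇒hasInducedPath₄ {m = m} C unique = _ , _ , _ , _ ,
  avoidsCycleVertex⇒inducedPath₄ C unique (# 3) (v≢ (λ ()) ∷ v≢ (λ ()) ∷ v≢ (λ ()) ∷ v≢ (λ ()) ∷ [])
    (v≢ λ ()) (v≢ λ ()) (v≢ λ ()) (close C) (path C zero) (path C (suc zero))
  where
  v≢ : {i j : Fin (3 + (2 + m))} → i ≢ j → vert C i ≢ vert C j
  v≢ = vert-≢ C

module _ {G : Graph n} (C : Cycle G 1) (unique : HasUniqueCycle G C) {p : Fin n} (p∉C : ∀ i → p ≢ vert C i) where
  private
    v≢ : {i j : Fin 4} → i ≢ j → vert C i ≢ vert C j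
    v≢ = vert-≢ C

  -- p, vᵢ, vᵢ₊₁, vᵢ₊₂ (indices mod 4) misses the cycle vertex vᵢ₊₃.
  square+outsideNeighbour⇒hasInducedPath₄ : (i : Fin 4) → Adj G p (vert C i) → HasInducedPath₄ G
  square+outsideNeighbour⇒hasInducedPath₄ zero p~v = _ , _ , _ , _ ,
    avoidsCycleVertex⇒inducedPath₄ C unique (# 3) (p∉C _ ∷ v≢ (λ ()) ∷ v≢ (λ ()) ∷ v≢ (λ ()) ∷ [])
      (p∉C _) (p∉C _) (v≢ λ ()) p~v (path C (# 0)) (path C (# 1))
  square+outsideNeighbour⇒hasInducedPath₄ (suc zero) p~v = _ , _ , _ , _ ,
    avoidsCycleVertex⇒inducedPath₄ C unique (# 0) (p∉C _ ∷ v≢ (λ ()) ∷ v≢ (λ ()) ∷ v≢ (λ ()) ∷ [])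
      (p∉C _) (p∉C _) (v≢ λ ()) p~v (path C (# 1)) (path C (# 2))
  square+outsideNeighbour⇒hasInducedPath₄ (suc (suc zero)) p~v = _ , _ , _ , _ ,
    avoidsCycleVertex⇒inducedPath₄ C unique (# 1) (p∉C _ ∷ v≢ (λ ()) ∷ v≢ (λ ()) ∷ v≢ (λ ()) ∷ [])
      (p∉C _) (p∉C _) (v≢ λ ()) p~v (path C (# 2)) (close C)
  square+outsideNeighbour⇒hasInducedPath₄ (suc (suc (suc zero))) p~v = _ , _ , _ , _ ,
    avoidsCycleVertex⇒inducedPath₄ C unique (# 2) (p∉C _ ∷ v≢ (λ ()) ∷ v≢ (λ ()) ∷ v≢ (λ ()) ∷ [])
      (p∉C _) (p∉C _) (v≢ λ ()) p~v (close C) (path C (# 0))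

unicyclic⇒hasInducedPath₄ : {G : Graph n} → 5 ≤ n → Connected G →
  (C : Cycle G m) → HasUniqueCycle G C → 4 ≤ cycleLength C → HasInducedPath₄ G
unicyclic⇒hasInducedPath₄ {m = 0} _ _ _ _ (s≤s (s≤s (s≤s ())))
unicyclic⇒hasInducedPath₄ {m = 1} {G = G} 5≤n connected C unique _ =
  let x , x∉C = ∃-outside-image 5≤n (vert C)
      p , p∉C , i , p~C = reach⇒boundary-edge G (vert C) (connected x (vert C zero)) x∉C (zero , refl)
  in square+outsideNeighbour⇒hasInducedPath₄ C unique p∉C i p~C
unicyclic⇒hasInducedPath₄ {m = Nat.suc (Nat.suc _)} _ _ C unique _ = longCycle⇒hasInducedPath₄ C unique

corollary3p5 : ∀ (n : ℕ) (G : Graph n) → 5 ≤ n → UnicyclicWithCycleLength≥ G 4 →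
    ZeroForcingNumber≤ (complement G) (n ∸ 3)
corollary3p5 n G 5≤n (connected , _ , C , unique , 4≤length) =
  hasInducedPath₄⇒Z-complement≤n∸3 G (unicyclic⇒hasInducedPath₄ 5≤n connected C unique 4≤length)
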